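{- Let $\Gamma$ be a finite group with a set $\mathcal{T}=\{\tau_1,\ldots,\tau_n\}$ of mutually distinct involutory generators, and let $\mathcal{G}=\mathcal{G}(\Gamma,\mathcal{T})$ be its Cayley graph, properly edge colored as in the context. Then the group $\Gamma_c(\mathcal{G})$ of color respecting automorphisms of $\mathcal{G}$ is the internal semidirect product $\Gamma_c(\mathcal{G})=\widehat{\Gamma}\rtimes Aut(\Gamma,\mathcal{T})\cong\Gamma\ltimes Aut(\Gamma,\mathcal{T})$, with $\widehat{\Gamma}\cong\Gamma$ normal.
   Context: The Cayley graph $\mathcal{G}(\Gamma,\mathcal{T})$ has vertex set $\Gamma$, with $u,v$ adjacent iff $v=\tau_i u$ for some $i$; such an edge receives color $i\in\{1,\ldots,n\}$. An automorphism of $\mathcal{G}$ is color respecting if it maps any two edges of equal color to edges of equal color. $\widehat{\Gamma}=\{\widehat g: g\in\Gamma\}$ where $\widehat g(u)=ug^{ -1}$. $Aut(\Gamma,\mathcal{T})$ is the group of group automorphisms of $\Gamma$ mapping $\mathcal{T}$ onto itself, acting on the vertex set $\Gamma$ of $\mathcal{G}$. -}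

module Defs where

open import Level using (Level) renaming (suc to lsuc)
open import Algebra.Structures using (IsGroup)
open import Data.Nat using (ℕ)
open import Data.Fin using (Fin)
open import Data.List using (List; foldr)
open import Data.Product using (Σ; ∃; _×_)
open import Relation.Nullary using (¬_)
open import Relation.Binary.PropositionalEquality using (_≡_; _≗_)
open import Function using (_∘_; id)
open import Function.Bundles using (_↔_)
open import Function.Definitions using (Injective)

record FiniteGroup (c : Level) : Set (lsuc c) where
  infixl 7 _∙_
  infix 8 _⁻¹
  field
    Carrier : Set c
    _∙_ : Carrier → Carrier → Carrier
    ε : Carrier
    _⁻¹ : Carrier → Carrier
    isGroup : IsGroup _≡_ _∙_ ε _⁻¹
    size : ℕ
    enum : Carrier ↔ Fin size

module Cayley {c : Level} (G : FiniteGroup c) {n : ℕ} (τ : Fin n → FiniteGroup.Carrier G) where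
  open FiniteGroup G

  word : List (Fin n) → Carrier
  word = foldr (λ i x → τ i ∙ x) ε

  IsInvolutoryGeneratingSet : Set c
  IsInvolutoryGeneratingSet =
    Injective _≡_ _≡_ τ
    × (∀ i → τ i ∙ τ i ≡ ε)
    × (∀ i → ¬ (τ i ≡ ε))
    × (∀ g → ∃ λ (w : List (Fin n)) → word w ≡ g)

  Adj : Carrier → Carrier → Set c
  Adj u v = ∃ λ i → v ≡ τ i ∙ u

  IsGraphAut : (Carrier → Carrier) → Set c
  IsGraphAut f =
    (∃ λ (g : Carrier → Carrier) → (f ∘ g ≗ id) × (g ∘ f ≗ id))
    × (∀ u v → Adj u v → Adj (f u) (f v))
    × (∀ u v → Adj (f u) (f v) → Adj u v)

  -- color respecting: the edge {u, τ_i u} (color i) is mapped to the edge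
  -- {f u, f (τ_i u)}, whose color is j when f (τ_i u) = τ_j f u;
  -- any two edges of equal color must have images of equal color.
  ColorRespecting : (Carrier → Carrier) → Set c
  ColorRespecting f =
    ∀ i j k u v → f (τ i ∙ u) ≡ τ j ∙ f u → f (τ i ∙ v) ≡ τ k ∙ f v → j ≡ k

  IsColorAut : (Carrier → Carrier) → Set c
  IsColorAut f = IsGraphAut f × ColorRespecting f

  hat : Carrier → Carrier → Carrier
  hat g u = u ∙ g ⁻¹

  IsAutΓT : (Carrier → Carrier) → Set c
  IsAutΓT σ =
    (∀ x y → σ (x ∙ y) ≡ σ x ∙ σ y)
    × (∃ λ (ρ : Carrier → Carrier) → (σ ∘ ρ ≗ id) × (ρ ∘ σ ≗ id))
    × (∀ i → ∃ λ j → σ (τ i) ≡ τ j)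
    × (∀ j → ∃ λ i → σ (τ i) ≡ τ j)

-- A colour-respecting automorphism φ permutes the colours uniformly,
-- φ (τᵢ u) = τ_{π i} (φ u) for all u.  As the τᵢ generate Γ, this gives
-- φ (a u) = σ a · φ u with σ a = φ a · (φ ε)⁻¹, so σ ∈ Aut(Γ,T) and φ = ĝ ∘ σ for
-- g = (φ ε)⁻¹.  Conversely ĝ and every σ ∈ Aut(Γ,T) permute the colours; ĝ fixes
-- the vertex ε only for g = ε, so Γ̂ ∩ Aut(Γ,T) is trivial; and conjugating ĥ by
-- φ = ĝ ∘ σ gives the translation by g · σ h · g⁻¹, so Γ̂ is normal.
module Submission where

open import Defs
open import Level using (Level)
open import Data.Nat using (ℕ)
open import Data.Fin using (Fin)
open import Data.List using (List; []; _∷_; map)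
open import Data.Product using (∃; ∃₂; _×_; _,_; proj₁; proj₂)
open import Relation.Binary.PropositionalEquality
  using (_≡_; _≗_; refl; sym; trans; cong; cong₂; subst₂; module ≡-Reasoning)
open import Function using (_∘_; id)
open import Function.Definitions using (Injective)
open import Algebra.Bundles using (Group)
open import Algebra.Structures using (IsGroup)
import Algebra.Properties.Group as GroupProperties
import Algebra.Morphism.Definitions as MorphismDefinitions

module GroupLemmas {c : Level} (G : FiniteGroup c) where
  open FiniteGroup G
  open IsGroup isGroup using (assoc; identityˡ; inverseʳ)
  open MorphismDefinitions Carrier Carrier _≡_ public using (Homomorphic₂)

  group : Group c c
  group = record { isGroup = isGroup }

  open GroupProperties group using (identityʳ-unique; inverseʳ-unique; ⁻¹-involutive; ⁻¹-anti-homo-∙)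

  ∙-homo⇒ε-homo : ∀ {σ} → Homomorphic₂ σ _∙_ _∙_ → σ ε ≡ ε
  ∙-homo⇒ε-homo {σ} hom = identityʳ-unique (σ ε) (σ ε) (trans (sym (hom ε ε)) (cong σ (identityˡ ε)))

  ∙-homo⇒⁻¹-homo : ∀ {σ} → Homomorphic₂ σ _∙_ _∙_ → ∀ x → σ (x ⁻¹) ≡ σ x ⁻¹
  ∙-homo⇒⁻¹-homo {σ} hom x = inverseʳ-unique (σ x) (σ (x ⁻¹))
    (trans (sym (hom x (x ⁻¹))) (trans (cong σ (inverseʳ x)) (∙-homo⇒ε-homo hom)))

  conjugate-⁻¹ : ∀ g a → (g ∙ a ∙ g ⁻¹) ⁻¹ ≡ g ∙ a ⁻¹ ∙ g ⁻¹
  conjugate-⁻¹ g a = begin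
    (g ∙ a ∙ g ⁻¹) ⁻¹      ≡⟨ ⁻¹-anti-homo-∙ (g ∙ a) (g ⁻¹) ⟩
    g ⁻¹ ⁻¹ ∙ (g ∙ a) ⁻¹   ≡⟨ cong₂ _∙_ (⁻¹-involutive g) (⁻¹-anti-homo-∙ g a) ⟩
    g ∙ (a ⁻¹ ∙ g ⁻¹)      ≡⟨ sym (assoc g (a ⁻¹) (g ⁻¹)) ⟩
    g ∙ a ⁻¹ ∙ g ⁻¹        ∎
    where open ≡-Reasoning

module CayleyLemmas {c : Level} (G : FiniteGroup c) {n : ℕ} (τ : Fin n → FiniteGroup.Carrier G) where
  open FiniteGroup G
  open Cayley G τ
  open GroupLemmas G
  open IsGroup isGroup using (assoc; identityˡ; identityʳ; inverseˡ; inverseʳ)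
  open GroupProperties group
    using (ε⁻¹≈ε; ⁻¹-involutive; ⁻¹-injective; ⁻¹-anti-homo-∙; ∙-cancelʳ; x≈z//y; //-rightDividesˡ; //-rightDividesʳ)
  open ≡-Reasoning

  Generating : Set c
  Generating = ∀ g → ∃ λ (w : List (Fin n)) → word w ≡ g

  Relabels : (Carrier → Carrier) → (Fin n → Fin n) → Set c
  Relabels φ π = ∀ i u → φ (τ i ∙ u) ≡ τ (π i) ∙ φ u

  relabels⇒adj-preserving : ∀ {φ π} → Relabels φ π → ∀ u v → Adj u v → Adj (φ u) (φ v)
  relabels⇒adj-preserving {π = π} rel u _ (i , refl) = π i , rel i u

  relabels⇒colorRespecting : ∀ {φ π} → Injective _≡_ _≡_ τ → Relabels φ π → ColorRespecting φ
  relabels⇒colorRespecting {φ} {π} inj rel i j k u v φu φv = trans (sym (imageColour u φu)) (imageColour v φv)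
    where
    imageColour : ∀ {j} u → φ (τ i ∙ u) ≡ τ j ∙ φ u → π i ≡ j
    imageColour u φu = inj (∙-cancelʳ (φ u) _ _ (trans (sym (rel i u)) φu))

  relabelling-inverses⇒isColorAut : ∀ {φ ψ π π′} → Injective _≡_ _≡_ τ →
    φ ∘ ψ ≗ id → ψ ∘ φ ≗ id → Relabels φ π → Relabels ψ π′ → IsColorAut φ
  relabelling-inverses⇒isColorAut {φ} {ψ} inj φψ ψφ φ-rel ψ-rel =
    ((ψ , φψ , ψφ) , relabels⇒adj-preserving φ-rel , reflects) , relabels⇒colorRespecting inj φ-rel
    where
    reflects : ∀ u v → Adj (φ u) (φ v) → Adj u v
    reflects u v adj = subst₂ Adj (ψφ u) (ψφ v) (relabels⇒adj-preserving ψ-rel (φ u) (φ v) adj)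

  colorRespecting⇒relabels : ∀ {φ} → (∀ u v → Adj u v → Adj (φ u) (φ v)) → ColorRespecting φ →
    ∃ λ π → Relabels φ π
  colorRespecting⇒relabels {φ} preserves respects = π , relabels
    where
    imageColour : Fin n → Carrier → Fin n
    imageColour i u = proj₁ (preserves u (τ i ∙ u) (i , refl))

    π : Fin n → Fin n
    π i = imageColour i ε

    relabels : Relabels φ π
    relabels i u = trans (proj₂ (preserves u (τ i ∙ u) (i , refl)))
      (cong (λ j → τ j ∙ φ u)
        (respects i _ _ u ε (proj₂ (preserves u _ (i , refl))) (proj₂ (preserves ε _ (i , refl)))))

  relabels-word : ∀ {φ π} → Relabels φ π → ∀ w u → φ (word w ∙ u) ≡ word (map π w) ∙ φ u
  relabels-word {φ} rel [] u = trans (cong φ (identityˡ u)) (sym (identityˡ (φ u)))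
  relabels-word {φ} {π} rel (i ∷ w) u = begin
    φ (τ i ∙ word w ∙ u)               ≡⟨ cong φ (assoc (τ i) (word w) u) ⟩
    φ (τ i ∙ (word w ∙ u))             ≡⟨ rel i (word w ∙ u) ⟩
    τ (π i) ∙ φ (word w ∙ u)           ≡⟨ cong (τ (π i) ∙_) (relabels-word rel w u) ⟩
    τ (π i) ∙ (word (map π w) ∙ φ u)   ≡⟨ sym (assoc (τ (π i)) (word (map π w)) (φ u)) ⟩
    τ (π i) ∙ word (map π w) ∙ φ u     ∎

  linearPart : (Carrier → Carrier) → Carrier → Carrier
  linearPart φ a = φ a ∙ φ ε ⁻¹

  relabels⇒translation : ∀ {φ π} → Generating → Relabels φ π → ∀ a u → φ (a ∙ u) ≡ linearPart φ a ∙ φ u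
  relabels⇒translation {φ} {π} gen rel a u with gen a
  ... | w , refl = trans (relabels-word rel w u) (cong (_∙ φ u) wordImage)
    where
    wordImage : word (map π w) ≡ linearPart φ (word w)
    wordImage = x≈z//y _ _ _ (sym (trans (cong φ (sym (identityʳ (word w)))) (relabels-word rel w ε)))

  linearPart-∙-homo : ∀ {φ π} → Generating → Relabels φ π → Homomorphic₂ (linearPart φ) _∙_ _∙_
  linearPart-∙-homo {φ} gen rel a b =
    trans (cong (_∙ φ ε ⁻¹) (relabels⇒translation gen rel a b)) (assoc (linearPart φ a) (φ b) (φ ε ⁻¹))

  linearPart-τ : ∀ {φ π} → Relabels φ π → ∀ i → linearPart φ (τ i) ≡ τ (π i)
  linearPart-τ {φ} {π} rel i = begin
    φ (τ i) ∙ φ ε ⁻¹          ≡⟨ cong (λ x → φ x ∙ φ ε ⁻¹) (sym (identityʳ (τ i))) ⟩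
    φ (τ i ∙ ε) ∙ φ ε ⁻¹      ≡⟨ cong (_∙ φ ε ⁻¹) (rel i ε) ⟩
    τ (π i) ∙ φ ε ∙ φ ε ⁻¹    ≡⟨ //-rightDividesʳ (φ ε) (τ (π i)) ⟩
    τ (π i)                   ∎

  relabelling-surjective : ∀ {φ π} → Injective _≡_ _≡_ τ → IsGraphAut φ → Relabels φ π →
    ∀ j → ∃ λ i → π i ≡ j
  relabelling-surjective {φ} {π} inj ((ψ , φψ , _) , _ , reflects) rel j
    with reflects ε (ψ (τ j ∙ φ ε)) (j , φψ (τ j ∙ φ ε))
  ... | i , ψτⱼ≡τᵢ = i , inj (∙-cancelʳ (φ ε) _ _ (begin
    τ (π i) ∙ φ ε        ≡⟨ sym (rel i ε) ⟩
    φ (τ i ∙ ε)          ≡⟨ cong φ (sym ψτⱼ≡τᵢ) ⟩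
    φ (ψ (τ j ∙ φ ε))    ≡⟨ φψ (τ j ∙ φ ε) ⟩
    τ j ∙ φ ε            ∎))

  hat-relabels : ∀ g → Relabels (hat g) id
  hat-relabels g i u = assoc (τ i) u (g ⁻¹)

  hat-∘ : ∀ g h → hat g ∘ hat h ≗ hat (g ∙ h)
  hat-∘ g h u = trans (assoc u (h ⁻¹) (g ⁻¹)) (cong (u ∙_) (sym (⁻¹-anti-homo-∙ g h)))

  hat-ε : hat ε ≗ id
  hat-ε u = trans (cong (u ∙_) ε⁻¹≈ε) (identityʳ u)

  hat-inverse : ∀ {g h} → g ∙ h ≡ ε → hat g ∘ hat h ≗ id
  hat-inverse {g} {h} gh≡ε u = trans (hat-∘ g h u) (trans (cong (λ x → hat x u) gh≡ε) (hat-ε u))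

  hat-fixing-ε⇒≡ε : ∀ {g} → hat g ε ≡ ε → g ≡ ε
  hat-fixing-ε⇒≡ε {g} fixes = ⁻¹-injective (trans (sym (identityˡ (g ⁻¹))) (trans fixes (sym ε⁻¹≈ε)))

  hat≗id⇒≡ε : ∀ g → hat g ≗ id → g ≡ ε
  hat≗id⇒≡ε g ĝ≗id = hat-fixing-ε⇒≡ε (ĝ≗id ε)

  hat≗∙-homo⇒≡ε : ∀ g σ → Homomorphic₂ σ _∙_ _∙_ → hat g ≗ σ → g ≡ ε
  hat≗∙-homo⇒≡ε g σ hom ĝ≗σ = hat-fixing-ε⇒≡ε (trans (ĝ≗σ ε) (∙-homo⇒ε-homo hom))

  hat-isColorAut : Injective _≡_ _≡_ τ → ∀ g → IsColorAut (hat g)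
  hat-isColorAut inj g = relabelling-inverses⇒isColorAut inj
    (hat-inverse (inverseʳ g)) (hat-inverse (inverseˡ g)) (hat-relabels g) (hat-relabels (g ⁻¹))

  autΓT⇒isColorAut : Injective _≡_ _≡_ τ → ∀ σ → IsAutΓT σ → IsColorAut σ
  autΓT⇒isColorAut inj σ (hom , (ρ , σρ , ρσ) , forth , back) =
    relabelling-inverses⇒isColorAut inj σρ ρσ σ-relabels ρ-relabels
    where
    σ-relabels : Relabels σ (proj₁ ∘ forth)
    σ-relabels i u = trans (hom (τ i) u) (cong (_∙ σ u) (proj₂ (forth i)))

    ρ-relabels : Relabels ρ (proj₁ ∘ back)
    ρ-relabels j u = trans (cong ρ (sym σ-preimage)) (ρσ (τ (proj₁ (back j)) ∙ ρ u))
      where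
      σ-preimage : σ (τ (proj₁ (back j)) ∙ ρ u) ≡ τ j ∙ u
      σ-preimage = trans (hom _ (ρ u)) (cong₂ _∙_ (proj₂ (back j)) (σρ u))

  colorAut-decomposition : Injective _≡_ _≡_ τ → Generating →
    ∀ φ → IsColorAut φ → ∃₂ λ g σ → IsAutΓT σ × (φ ≗ hat g ∘ σ)
  colorAut-decomposition inj gen φ (aut@((ψ , φψ , ψφ) , preserves , _) , respects)
    with colorRespecting⇒relabels preserves respects
  ... | π , rel = φ ε ⁻¹ , σ , (linearPart-∙-homo gen rel , (ρ , σρ , ρσ) , forth , back) , φ≗ĝ∘σ
    where
    σ : Carrier → Carrier
    σ = linearPart φ

    ρ : Carrier → Carrier
    ρ x = ψ (x ∙ φ ε)

    σρ : σ ∘ ρ ≗ id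
    σρ x = trans (cong (_∙ φ ε ⁻¹) (φψ (x ∙ φ ε))) (//-rightDividesʳ (φ ε) x)

    ρσ : ρ ∘ σ ≗ id
    ρσ x = trans (cong ψ (//-rightDividesˡ (φ ε) (φ x))) (ψφ x)

    forth : ∀ i → ∃ λ j → σ (τ i) ≡ τ j
    forth i = π i , linearPart-τ rel i

    back : ∀ j → ∃ λ i → σ (τ i) ≡ τ j
    back j with relabelling-surjective inj aut rel j
    ... | i , πi≡j = i , trans (linearPart-τ rel i) (cong τ πi≡j)

    φ≗ĝ∘σ : φ ≗ hat (φ ε ⁻¹) ∘ σ
    φ≗ĝ∘σ u = trans (sym (//-rightDividesˡ (φ ε) (φ u))) (cong (σ u ∙_) (sym (⁻¹-involutive (φ ε))))

  hat-conjugation : ∀ {φ ψ σ} g → Homomorphic₂ σ _∙_ _∙_ → φ ≗ hat g ∘ σ → φ ∘ ψ ≗ id →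
    ∀ h → φ ∘ hat h ∘ ψ ≗ hat (g ∙ σ h ∙ g ⁻¹)
  hat-conjugation {φ} {ψ} {σ} g hom φ≗ĝ∘σ φψ h x = begin
    φ (ψ x ∙ h ⁻¹)                 ≡⟨ φ≗ĝ∘σ (ψ x ∙ h ⁻¹) ⟩
    σ (ψ x ∙ h ⁻¹) ∙ g ⁻¹          ≡⟨ cong (_∙ g ⁻¹) (hom (ψ x) (h ⁻¹)) ⟩
    σ (ψ x) ∙ σ (h ⁻¹) ∙ g ⁻¹      ≡⟨ cong₂ (λ a b → a ∙ b ∙ g ⁻¹) σψx≡xg (∙-homo⇒⁻¹-homo hom h) ⟩
    x ∙ g ∙ σ h ⁻¹ ∙ g ⁻¹          ≡⟨ assoc (x ∙ g) (σ h ⁻¹) (g ⁻¹) ⟩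
    x ∙ g ∙ (σ h ⁻¹ ∙ g ⁻¹)        ≡⟨ assoc x g (σ h ⁻¹ ∙ g ⁻¹) ⟩
    x ∙ (g ∙ (σ h ⁻¹ ∙ g ⁻¹))      ≡⟨ cong (x ∙_) (sym (assoc g (σ h ⁻¹) (g ⁻¹))) ⟩
    x ∙ (g ∙ σ h ⁻¹ ∙ g ⁻¹)        ≡⟨ cong (x ∙_) (sym (conjugate-⁻¹ g (σ h))) ⟩
    x ∙ (g ∙ σ h ∙ g ⁻¹) ⁻¹        ∎
    where
    σψx≡xg : σ (ψ x) ≡ x ∙ g
    σψx≡xg = trans (x≈z//y (σ (ψ x)) (g ⁻¹) x (trans (sym (φ≗ĝ∘σ (ψ x))) (φψ x)))
                   (cong (x ∙_) (⁻¹-involutive g))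

  hat-normal : Injective _≡_ _≡_ τ → Generating →
    ∀ φ ψ → IsColorAut φ → φ ∘ ψ ≗ id → ∀ h → ∃ λ h′ → φ ∘ hat h ∘ ψ ≗ hat h′
  hat-normal inj gen φ ψ φ-aut φψ h with colorAut-decomposition inj gen φ φ-aut
  ... | g , σ , (hom , _) , φ≗ĝ∘σ = g ∙ σ h ∙ g ⁻¹ , hat-conjugation g hom φ≗ĝ∘σ φψ h

mainTheorem5 : ∀ {c : Level} (G : FiniteGroup c) (n : ℕ) (τ : Fin n → FiniteGroup.Carrier G) →
    let open FiniteGroup G
        open Cayley G τ
    in IsInvolutoryGeneratingSet →
       (∀ g → IsColorAut (hat g))
       × (∀ σ → IsAutΓT σ → IsColorAut σ)
       × (∀ g h → hat g ∘ hat h ≗ hat (g ∙ h))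
       × (∀ g → hat g ≗ id → g ≡ ε)
       × (∀ φ ψ → IsColorAut φ → φ ∘ ψ ≗ id → ψ ∘ φ ≗ id →
            ∀ g → ∃ λ g′ → φ ∘ hat g ∘ ψ ≗ hat g′)
       × (∀ g σ → IsAutΓT σ → hat g ≗ σ → g ≡ ε)
       × (∀ φ → IsColorAut φ → ∃₂ λ g σ → IsAutΓT σ × (φ ≗ hat g ∘ σ))
mainTheorem5 G n τ (τ-injective , _ , _ , generates) =
    hat-isColorAut τ-injective
  , autΓT⇒isColorAut τ-injective
  , hat-∘
  , hat≗id⇒≡ε
  , (λ φ ψ φ-aut φψ _ → hat-normal τ-injective generates φ ψ φ-aut φψ)
  , (λ g σ (σ-hom , _) → hat≗∙-homo⇒≡ε g σ σ-hom)
  , colorAut-decomposition τ-injective generates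
  where open CayleyLemmas G τ
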